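{- A tournament $T$ with at least two vertices is an acyclically indecomposable finite tournament of inversion index at most $1$ if and only if $T$ is isomorphic to one of $U_{2n+1}$, $\underline2(\underline1,U_{2n+1})$, $\underline2(U_{2n+1},\underline1)$ or $\underline3(\underline1,U_{2n+1},\underline1)$ for some $n\geq1$, where $U_{2n+1}:=Inv(\underline{2n+1},\{0,2,4,\dots,2n\})$.
   Context: For $n\in\mathbb N$, $\underline n$ is the tournament with vertex set $\{0,\dots,n-1\}$ and arcs $(i,j)$ for $0\le i<j<n$. For a tournament $T$ and $X\subseteq V(T)$, $Inv(T,X)$ is obtained by reversing all arcs with both ends in $X$; $Inv(T,(X_i)_{i<m})$ reverses an arc $(x,y)$ iff the number of $i<m$ with $\{x,y\}\subseteq X_i$ is odd. A tournament is acyclic if it does not embed the 3-cycle; the inversion index $i(T)$ is the least $m$ such that some $Inv(T,(X_i)_{i<m})$ is acyclic. A subset $X$ of $V(T)$ is an interval of $T$ if for every $y\notin X$ and $x,x'\in X$, $(x,y)\in A(T)\iff(x',y)\in A(T)$ and $(y,x)\in A(T)\iff(y,x')\in A(T)$. $T$ is acyclically indecomposable if no interval $X$ of $T$ with $|X|\ge2$ induces an acyclic subtournament. For tournaments $S_0,\dots,S_{k-1}$ with disjoint vertex sets, $\underline k(S_0,\dots,S_{k-1})$ is the lexicographic sum: vertex set $\bigcup_i V(S_i)$, arcs those of each $S_i$ together with all $(x,y)$ with $x\in V(S_i)$, $y\in V(S_j)$, $i<j$. $\underline1$ is the one-vertex tournament. -}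

module Defs where

open import Data.Bool using (Bool; true; false; not; _∧_; _xor_; if_then_else_)
open import Data.Nat using (ℕ; zero; suc; _+_; _*_; _≤_)
open import Data.Nat.Properties using (_<?_)
open import Data.Fin using (Fin; toℕ; splitAt)
open import Data.Sum using (_⊎_; inj₁; inj₂)
open import Data.Vec using (Vec; foldr′)
open import Data.Product using (Σ; ∃; ∃-syntax; _×_; _,_)
open import Data.Empty using (⊥)
open import Function.Bundles using (_↔_; Inverse)
open import Relation.Nullary using (¬_; does)
open import Relation.Binary.PropositionalEquality using (_≡_; _≢_)

-- A (loopless-by-hypothesis) digraph on vertex set Fin n, given by its arc indicator:
-- arc x y ≡ true  iff  (x , y) is an arc.
Digraph : ℕ → Set
Digraph n = Fin n → Fin n → Bool

IsTournament : ∀ {n} → Digraph n → Set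
IsTournament {n} T =
  (∀ (x : Fin n) → T x x ≡ false) ×
  (∀ (x y : Fin n) → x ≢ y → T x y ≡ not (T y x))

VSubset : ℕ → Set
VSubset n = Fin n → Bool

chain : (n : ℕ) → Digraph n
chain n i j = does (toℕ i <? toℕ j)

oddCover : ∀ {n m} → Vec (VSubset n) m → Fin n → Fin n → Bool
oddCover Xs x y = foldr′ (λ X b → (X x ∧ X y) xor b) false Xs

Inv : ∀ {n m} → Digraph n → Vec (VSubset n) m → Digraph n
Inv T Xs x y = if oddCover Xs x y then T y x else T x y

Inv1 : ∀ {n} → Digraph n → VSubset n → Digraph n
Inv1 T X = Inv T (X Data.Vec.∷ Data.Vec.[])

HasCycle3In : ∀ {n} → Digraph n → VSubset n → Set
HasCycle3In {n} T X =
  Σ (Fin n) λ x → Σ (Fin n) λ y → Σ (Fin n) λ z →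
    (X x ≡ true) × (X y ≡ true) × (X z ≡ true) ×
    (T x y ≡ true) × (T y z ≡ true) × (T z x ≡ true)

Acyclic : ∀ {n} → Digraph n → Set
Acyclic T = ¬ HasCycle3In T (λ _ → true)

AcyclicOn : ∀ {n} → Digraph n → VSubset n → Set
AcyclicOn T X = ¬ HasCycle3In T X

-- i(T) ≤ k : some family of m ≤ k subsets makes T acyclic after inversion
-- (i(T) is the least such m, so i(T) ≤ k iff such an m ≤ k exists).
InvIndexAtMost : ∀ {n} → ℕ → Digraph n → Set
InvIndexAtMost {n} k T =
  Σ ℕ λ m → (m ≤ k) × Σ (Vec (VSubset n) m) λ Xs → Acyclic (Inv T Xs)

IsInterval : ∀ {n} → Digraph n → VSubset n → Set
IsInterval {n} T X =
  ∀ (y x x′ : Fin n) → X y ≡ false → X x ≡ true → X x′ ≡ true →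
    (T x y ≡ T x′ y) × (T y x ≡ T y x′)

AtLeastTwo : ∀ {n} → VSubset n → Set
AtLeastTwo {n} X = Σ (Fin n) λ x → Σ (Fin n) λ x′ → x ≢ x′ × (X x ≡ true) × (X x′ ≡ true)

AcyclicallyIndecomposable : ∀ {n} → Digraph n → Set
AcyclicallyIndecomposable {n} T =
  ∀ (X : VSubset n) → IsInterval T X → AtLeastTwo X → ¬ AcyclicOn T X

_≅_ : ∀ {n m} → Digraph n → Digraph m → Set
_≅_ {n} {m} T S =
  Σ (Fin n ↔ Fin m) λ f →
    ∀ (x y : Fin n) → T x y ≡ S (Inverse.to f x) (Inverse.to f y)

lex2 : ∀ {a b} → Digraph a → Digraph b → Digraph (a + b)
lex2 {a} S₀ S₁ x y with splitAt a x | splitAt a y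
... | inj₁ i | inj₁ j = S₀ i j
... | inj₂ i | inj₂ j = S₁ i j
... | inj₁ _ | inj₂ _ = true
... | inj₂ _ | inj₁ _ = false

-- Lexicographic sum 3̲(S₀,S₁,S₂), realised as 2̲(2̲(S₀,S₁),S₂) (identical arc set).
lex3 : ∀ {a b c} → Digraph a → Digraph b → Digraph c → Digraph ((a + b) + c)
lex3 S₀ S₁ S₂ = lex2 (lex2 S₀ S₁) S₂

one : Digraph 1
one = chain 1

isEven : ℕ → Bool
isEven zero = true
isEven (suc k) = not (isEven k)

U : (n : ℕ) → Digraph (suc (2 * n))
U n = Inv1 (chain (suc (2 * n))) (λ i → isEven (toℕ i))

-- If Inv(T, X) is acyclic it is a chain, so T ≅ Inv(n̲, Q) for some Q ⊆ n̲. In Inv(n̲, Q) two consecutive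
-- vertices that are both in Q or both outside Q form an acyclic interval, and if |Q| ≤ 1 then Inv(n̲, Q) = n̲ is
-- acyclic. So indecomposability forces Q to alternate along n̲ and to have two members, and the alternating Q are
-- classified by whether 0 and n - 1 belong to Q: these are the four listed tournaments. Conversely, for alternating Q
-- an interval with two vertices contains two consecutive ones; then every member of Q lies in it (a member outside
-- would separate the two), and members u, u + 2 together with u + 1 form a 3-cycle.

module Submission where

open import Defs
open import Data.Nat using (ℕ; _≤_)
open import Data.Fin using (Fin)
open import Data.Product using (Σ; _×_)
open import Data.Sum using (_⊎_)
open import Function.Bundles using (_⇔_)

open import Data.Bool using (Bool; true; false; not; _∧_; _∨_; _xor_; if_then_else_)
open import Data.Bool.Properties using (not-involutive; not-injective; not-¬; ¬-not; ∧-comm; ∧-zeroʳ)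
  renaming (_≟_ to _≟ᵇ_)
open import Data.Empty using (⊥-elim)
open import Data.Fin using (zero; suc; toℕ; fromℕ<; inject₁; splitAt; _↑ˡ_; _↑ʳ_; _≟_; _>_; punchOut)
open import Data.Fin.Induction using (Acc; acc; >-wellFounded; <-weakInduction)
open import Data.Fin.Properties
  using (toℕ-injective; toℕ-fromℕ<; toℕ<n; toℕ-inject₁; toℕ-↑ˡ; toℕ-↑ʳ; splitAt⁻¹-↑ˡ; splitAt⁻¹-↑ʳ;
         any?; injective⇒≤; punchOut-injective)
open import Data.Fin.Subset using (Subset; ⊤; ∣_∣; _∈_)
open import Data.Fin.Subset.Properties using (p⊂q⇒∣p∣<∣q∣; ∈⊤; ∣⊤∣≡n)
open import Data.Nat using (zero; suc; _+_; _*_; _<_; z≤n; s≤s)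
open import Data.Nat.Properties
  using (_<?_; <-irrefl; <-asym; <-trans; <-cmp; ≤-refl; ≤-trans; ≤-<-trans; ≤∧≢⇒<; 1+n≰n; 1+n≢n;
         m≤m+n; *-suc; *-monoʳ-≤; +-identityʳ; m≤n⇒∃[o]m+o≡n)
open import Data.Product using (_,_; proj₁; proj₂; ∃)
open import Data.Sum using (inj₁; inj₂)
open import Data.Vec using ([]; _∷_; tabulate)
open import Data.Vec.Properties using (lookup∘tabulate; lookup⇒[]=; []=⇒lookup)
open import Function using (_∘_)
open import Function.Bundles using (_↔_; Inverse; mk↔ₛ′; mk⇔)
open import Function.Construct.Composition using (_↔-∘_)
open import Function.Construct.Identity using (↔-id)
open import Function.Construct.Symmetry using (↔-sym)
open import Relation.Binary.Definitions using (tri<; tri≈; tri>)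
open import Relation.Binary.PropositionalEquality
  using (_≡_; _≢_; refl; sym; trans; cong; cong₂; subst; module ≡-Reasoning)
open import Relation.Nullary using (does; yes; no; ¬?)
open import Relation.Nullary.Decidable using (Dec; dec-true; dec-false; _×-dec_)

true≢false : true ≢ false
true≢false ()

∧-true : ∀ {a b} → a ∧ b ≡ true → a ≡ true × b ≡ true
∧-true {true} {true} _ = refl , refl

∈∉⇒≢ : ∀ {n} {X : VSubset n} {x y : Fin n} → X x ≡ true → X y ≡ false → x ≢ y
∈∉⇒≢ x∈ y∉ refl = true≢false (trans (sym x∈) y∉)

≗⇒≅ : ∀ {n} {T S : Digraph n} → (∀ x y → T x y ≡ S x y) → T ≅ S
≗⇒≅ T≗S = ↔-id _ , T≗S

≅-sym : ∀ {n m} {T : Digraph n} {S : Digraph m} → T ≅ S → S ≅ T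
≅-sym {T = T} {S} (f , arc) = ↔-sym f , λ u v → begin
  S u v                         ≡⟨ sym (cong₂ S (strictlyInverseˡ u) (strictlyInverseˡ v)) ⟩
  S (to (from u)) (to (from v)) ≡⟨ sym (arc (from u) (from v)) ⟩
  T (from u) (from v)           ∎
  where
  open Inverse f
  open ≡-Reasoning

-- The digraphs related by an isomorphism occur in its type only applied to images under the bijection, so
-- Agda cannot infer them from it: the middle and target of ≅-trans (and the like) are often given explicitly.
≅-trans : ∀ {n m k} {T : Digraph n} {S : Digraph m} {R : Digraph k} → T ≅ S → S ≅ R → T ≅ R
≅-trans (f , arc) (g , arc′) = g ↔-∘ f , λ x y → trans (arc x y) (arc′ _ _)

module _ {n m} {T : Digraph n} {S : Digraph m} (T≅S : T ≅ S) where

  open Inverse (proj₁ T≅S) using (to; from; strictlyInverseˡ)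

  private
    arc : ∀ x y → T x y ≡ S (to x) (to y)
    arc = proj₂ T≅S

  isInterval-≅ : ∀ {X} → IsInterval S X → IsInterval T (X ∘ to)
  isInterval-≅ int y x x′ y∉ x∈ x′∈ =
    let (e₁ , e₂) = int (to y) (to x) (to x′) y∉ x∈ x′∈
    in trans (arc x y) (trans e₁ (sym (arc x′ y))) , trans (arc y x) (trans e₂ (sym (arc y x′)))

  atLeastTwo-≅ : ∀ {X} → AtLeastTwo X → AtLeastTwo (X ∘ to)
  atLeastTwo-≅ {X} (u , v , u≢v , u∈ , v∈) =
    from u , from v , u≢v ∘ from-injective , member u u∈ , member v v∈
    where
    from-injective : from u ≡ from v → u ≡ v
    from-injective e = trans (sym (strictlyInverseˡ u)) (trans (cong to e) (strictlyInverseˡ v))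
    member : ∀ w → X w ≡ true → X (to (from w)) ≡ true
    member w w∈ = trans (cong X (strictlyInverseˡ w)) w∈

  acyclicOn-≅ : ∀ {X} → AcyclicOn S X → AcyclicOn T (X ∘ to)
  acyclicOn-≅ acyc (a , b , c , a∈ , b∈ , c∈ , ab , bc , ca) =
    acyc (to a , to b , to c , a∈ , b∈ , c∈ ,
          trans (sym (arc a b)) ab , trans (sym (arc b c)) bc , trans (sym (arc c a)) ca)

  indecomposable-≅ : AcyclicallyIndecomposable T → AcyclicallyIndecomposable S
  indecomposable-≅ ind X int two acyc =
    ind (X ∘ to) (isInterval-≅ int) (atLeastTwo-≅ two) (acyclicOn-≅ acyc)

  Inv1-≅ : ∀ {X : VSubset n} {Y : VSubset m} → (∀ x → X x ≡ Y (to x)) → Inv1 T X ≅ Inv1 S Y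
  Inv1-≅ {X} {Y} X≡Y = proj₁ T≅S , inverted
    where
    inverted : ∀ x y → Inv1 T X x y ≡ Inv1 S Y (to x) (to y)
    inverted x y rewrite X≡Y x | X≡Y y with Y (to x) | Y (to y)
    ... | true  | true  = arc y x
    ... | true  | false = arc x y
    ... | false | _     = arc x y

Inv1-involutive : ∀ {n} (T : Digraph n) (X : VSubset n) x y → Inv1 (Inv1 T X) X x y ≡ T x y
Inv1-involutive T X x y with X x | X y
... | true  | true  = refl
... | true  | false = refl
... | false | _     = refl

Inv1-isTournament : ∀ {n} {T : Digraph n} {X : VSubset n} → IsTournament T → IsTournament (Inv1 T X)
Inv1-isTournament {T = T} {X} (irreflexive , antisymmetric) = irreflexive′ , antisymmetric′
  where
  irreflexive′ : ∀ x → Inv1 T X x x ≡ false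
  irreflexive′ x with X x
  ... | true  = irreflexive x
  ... | false = irreflexive x
  antisymmetric′ : ∀ x y → x ≢ y → Inv1 T X x y ≡ not (Inv1 T X y x)
  antisymmetric′ x y x≢y with X x | X y
  ... | true  | true  = antisymmetric y x (x≢y ∘ sym)
  ... | true  | false = antisymmetric x y x≢y
  ... | false | true  = antisymmetric x y x≢y
  ... | false | false = antisymmetric x y x≢y

index≤1⇒acyclicInversion : ∀ {n} {T : Digraph n} → InvIndexAtMost 1 T →
  Σ (VSubset n) λ X → Acyclic (Inv1 T X)
index≤1⇒acyclicInversion (0 , _ , [] , acyc) = (λ _ → false) , acyc
index≤1⇒acyclicInversion (1 , _ , X ∷ [] , acyc) = X , acyc
index≤1⇒acyclicInversion (suc (suc _) , s≤s () , _)

index≤1-≅ : ∀ {n m} {T : Digraph n} {S : Digraph m} → T ≅ S → InvIndexAtMost 1 S → InvIndexAtMost 1 T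
index≤1-≅ {T = T} {S} T≅S idx =
  let (X , acyc) = index≤1⇒acyclicInversion idx
  in 1 , ≤-refl , X ∘ to ∷ [] ,
     acyclicOn-≅ {S = Inv1 S X} (Inv1-≅ {S = S} T≅S {Y = X} λ _ → refl) acyc
  where open Inverse (proj₁ T≅S) using (to)

forward⇒acyclic : ∀ {n} {T : Digraph n} → (∀ x y → T x y ≡ true → toℕ x < toℕ y) → Acyclic T
forward⇒acyclic forward (a , b , c , _ , _ , _ , ab , bc , ca) =
  <-irrefl refl (<-trans (forward a b ab) (<-trans (forward b c bc) (forward c a ca)))

injective⇒surjective : ∀ {n} {f : Fin n → Fin n} → (∀ {x y} → f x ≡ f y → x ≡ y) →
  ∀ y → ∃ λ x → f x ≡ y
injective⇒surjective {suc n} {f} f-injective y with any? (λ x → f x ≟ y)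
... | yes found = found
... | no missed = ⊥-elim (1+n≰n (injective⇒≤ punchOut∘f-injective))
  where
  punchOut∘f : Fin (suc n) → Fin n
  punchOut∘f x = punchOut {i = y} λ e → missed (x , sym e)
  punchOut∘f-injective : ∀ {x x′} → punchOut∘f x ≡ punchOut∘f x′ → x ≡ x′
  punchOut∘f-injective {x} {x′} e =
    f-injective (punchOut-injective (λ e′ → missed (x , sym e′)) (λ e′ → missed (x′ , sym e′)) e)

injective⇒↔ : ∀ {n} (f : Fin n → Fin n) → (∀ {x y} → f x ≡ f y → x ≡ y) → Fin n ↔ Fin n
injective⇒↔ f f-injective = mk↔ₛ′ f (proj₁ ∘ preimage) (proj₂ ∘ preimage)
  (λ x → f-injective (proj₂ (preimage (f x))))
  where
  preimage = injective⇒surjective f-injective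

module AcyclicTournament {n} {A : Digraph n} (tournament : IsTournament A) (acyclic : Acyclic A) where

  private
    irreflexive = proj₁ tournament
    antisymmetric = proj₂ tournament

  arc-flip : ∀ {x y} → x ≢ y → A x y ≡ false → A y x ≡ true
  arc-flip {x} {y} x≢y xy = trans (antisymmetric y x (x≢y ∘ sym)) (cong not xy)

  transitive : ∀ {x y z} → A x y ≡ true → A y z ≡ true → A x z ≡ true
  transitive {x} {y} {z} xy yz with x ≟ z | A x z in xz
  ... | _        | true  = refl
  ... | yes refl | false =
    ⊥-elim (true≢false (trans (sym yz) (trans (antisymmetric y x y≢x) (cong not xy))))
    where
    y≢x : y ≢ x
    y≢x refl = true≢false (trans (sym xy) (irreflexive x))
  ... | no x≢z   | false = ⊥-elim (acyclic (x , y , z , refl , refl , refl , xy , yz , arc-flip x≢z xz))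

  predecessors : Fin n → Subset n
  predecessors y = tabulate (λ x → A x y)

  ∈-predecessors : ∀ {x y} → A x y ≡ true → x ∈ predecessors y
  ∈-predecessors {x} {y} xy = lookup⇒[]= x _ (trans (lookup∘tabulate _ x) xy)

  ∈-predecessors⁻ : ∀ {x y} → x ∈ predecessors y → A x y ≡ true
  ∈-predecessors⁻ {x} x∈ = trans (sym (lookup∘tabulate _ x)) ([]=⇒lookup x∈)

  rank : Fin n → ℕ
  rank y = ∣ predecessors y ∣

  rank-< : ∀ {x y} → A x y ≡ true → rank x < rank y
  rank-< {x} xy = p⊂q⇒∣p∣<∣q∣
    ( ∈-predecessors ∘ (λ zx → transitive zx xy) ∘ ∈-predecessors⁻
    , x , ∈-predecessors xy , λ x∈ → true≢false (trans (sym (∈-predecessors⁻ x∈)) (irreflexive x)))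

  rank<n : ∀ y → rank y < n
  rank<n y = subst (rank y <_) (∣⊤∣≡n n) (p⊂q⇒∣p∣<∣q∣
    ( (λ _ → ∈⊤) , y , ∈⊤ , λ y∈ → true≢false (trans (sym (∈-predecessors⁻ y∈)) (irreflexive y))))

  rank-arc : ∀ x y → A x y ≡ does (rank x <? rank y)
  rank-arc x y with x ≟ y
  ... | yes refl = trans (irreflexive x) (sym (dec-false (rank x <? rank x) (<-irrefl refl)))
  ... | no x≢y with A x y in xy
  ...   | true  = sym (dec-true (rank x <? rank y) (rank-< xy))
  ...   | false = sym (dec-false (rank x <? rank y) (<-asym (rank-< (arc-flip x≢y xy))))

  rank-injective : ∀ {x y} → rank x ≡ rank y → x ≡ y
  rank-injective {x} {y} same with x ≟ y
  ... | yes x≡y = x≡y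
  ... | no x≢y with A x y in xy
  ...   | true  = ⊥-elim (<-irrefl same (rank-< xy))
  ...   | false = ⊥-elim (<-irrefl (sym same) (rank-< (arc-flip x≢y xy)))

  position : Fin n → Fin n
  position y = fromℕ< (rank<n y)

  position-injective : ∀ {x y} → position x ≡ position y → x ≡ y
  position-injective e = rank-injective (trans (sym (toℕ-fromℕ< _)) (trans (cong toℕ e) (toℕ-fromℕ< _)))

  acyclic⇒≅chain : A ≅ chain n
  acyclic⇒≅chain = injective⇒↔ position position-injective , λ x y →
    trans (rank-arc x y)
          (sym (cong₂ (λ i j → does (i <? j)) (toℕ-fromℕ< (rank<n x)) (toℕ-fromℕ< (rank<n y))))

open AcyclicTournament using (acyclic⇒≅chain)

-- invChain Q x y reduces definitionally to invArc (Q x) (Q y) (toℕ x) (toℕ y): an arc of Inv(n̲, Q) is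
-- determined by the memberships and the positions of its ends.
invArc : Bool → Bool → ℕ → ℕ → Bool
invArc qi qj i j = if (qi ∧ qj) xor false then does (j <? i) else does (i <? j)

invChain : ∀ {n} → VSubset n → Digraph n
invChain {n} Q = Inv1 (chain n) Q

invArc-< : ∀ qi qj {i j} → i < j → invArc qi qj i j ≡ not (qi ∧ qj)
invArc-< true  true  i<j = dec-false (_ <? _) (<-asym i<j)
invArc-< true  false i<j = dec-true (_ <? _) i<j
invArc-< false _     i<j = dec-true (_ <? _) i<j

invArc-> : ∀ qi qj {i j} → j < i → invArc qi qj i j ≡ qi ∧ qj
invArc-> true  true  j<i = dec-true (_ <? _) j<i
invArc-> true  false j<i = dec-false (_ <? _) (<-asym j<i)
invArc-> false _     j<i = dec-false (_ <? _) (<-asym j<i)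

invArc-irrefl : ∀ qi qj i → invArc qi qj i i ≡ false
invArc-irrefl qi qj i with (qi ∧ qj) xor false
... | true  = dec-false (i <? i) (<-irrefl refl)
... | false = dec-false (i <? i) (<-irrefl refl)

invArc-true : ∀ {qi qj i j} → invArc qi qj i j ≡ true → i < j ⊎ (j < i × qi ∧ qj ≡ true)
invArc-true {qi} {qj} {i} {j} e with <-cmp i j
... | tri< i<j _ _ = inj₁ i<j
... | tri≈ _ refl _ = ⊥-elim (true≢false (trans (sym e) (invArc-irrefl qi qj i)))
... | tri> _ _ j<i = inj₂ (j<i , trans (sym (invArc-> qi qj j<i)) e)

invArc-forward : ∀ {qi qj i j} → qi ∧ qj ≡ false → i < j →
  invArc qi qj i j ≡ true × invArc qj qi j i ≡ false
invArc-forward {qi} {qj} nonmembers i<j =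
  trans (invArc-< qi qj i<j) (cong not nonmembers) ,
  trans (invArc-> qj qi i<j) (trans (∧-comm qj qi) nonmembers)

invArc-sameSide : ∀ {qi qj qk i j k} → qj ≡ qk → (i < j × i < k) ⊎ (j < i × k < i) →
  (invArc qj qi j i ≡ invArc qk qi k i) × (invArc qi qj i j ≡ invArc qi qk i k)
invArc-sameSide {qi} {qj} refl (inj₁ (i<j , i<k)) =
  trans (invArc-> qj qi i<j) (sym (invArc-> qj qi i<k)) ,
  trans (invArc-< qi qj i<j) (sym (invArc-< qi qj i<k))
invArc-sameSide {qi} {qj} refl (inj₂ (j<i , k<i)) =
  trans (invArc-< qj qi j<i) (sym (invArc-< qj qi k<i)) ,
  trans (invArc-> qi qj j<i) (sym (invArc-> qi qj k<i))

invArc-separates : ∀ {qj qk i j k} → (i < j × i < k) ⊎ (j < i × k < i) →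
  invArc true qj i j ≡ invArc true qk i k → qj ≡ qk
invArc-separates {qj} {qk} (inj₁ (i<j , i<k)) e =
  not-injective (trans (sym (invArc-< true qj i<j)) (trans e (invArc-< true qk i<k)))
invArc-separates {qj} {qk} (inj₂ (j<i , k<i)) e =
  trans (sym (invArc-> true qj j<i)) (trans e (invArc-> true qk k<i))

invChain-irrefl : ∀ {n} (Q : VSubset n) x → invChain Q x x ≡ false
invChain-irrefl Q x = invArc-irrefl (Q x) (Q x) (toℕ x)

invChain-cong : ∀ {n} {Q Q′ : VSubset n} → (∀ x → Q x ≡ Q′ x) → ∀ x y → invChain Q x y ≡ invChain Q′ x y
invChain-cong Q≗Q′ x y = cong₂ (λ qx qy → invArc qx qy (toℕ x) (toℕ y)) (Q≗Q′ x) (Q≗Q′ y)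

chain-acyclic : ∀ n → Acyclic (chain n)
chain-acyclic n = forward⇒acyclic λ x y xy → forward (invArc-true {false} {false} xy)
  where
  forward : ∀ {i j} → i < j ⊎ (j < i × false ≡ true) → i < j
  forward (inj₁ i<j) = i<j

invChain-index≤1 : ∀ {n} (Q : VSubset n) → InvIndexAtMost 1 (invChain Q)
invChain-index≤1 {n} Q =
  1 , ≤-refl , Q ∷ [] , acyclicOn-≅ (≗⇒≅ (Inv1-involutive (chain n) Q)) (chain-acyclic n)

index≤1⇒≅invChain : ∀ {n} {T : Digraph n} → IsTournament T → InvIndexAtMost 1 T →
  Σ (VSubset n) λ Q → T ≅ invChain Q
index≤1⇒≅invChain {n} {T} tournament idx = X ∘ from , T≅invChain
  where
  X : VSubset n
  X = proj₁ (index≤1⇒acyclicInversion idx)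
  sorted : Inv1 T X ≅ chain n
  sorted = acyclic⇒≅chain (Inv1-isTournament {X = X} tournament) (proj₂ (index≤1⇒acyclicInversion idx))
  open Inverse (proj₁ sorted) using (from; strictlyInverseʳ)
  T≅invChain : T ≅ invChain (X ∘ from)
  T≅invChain = ≅-trans {S = Inv1 (Inv1 T X) X} {R = invChain (X ∘ from)}
    (≗⇒≅ λ x y → sym (Inv1-involutive T X x y))
    (Inv1-≅ {S = chain n} sorted {Y = X ∘ from} λ x → cong X (sym (strictlyInverseʳ x)))

Alternating : ∀ {n} → VSubset n → Set
Alternating {n} Q = ∀ (p q : Fin n) → toℕ q ≡ suc (toℕ p) → Q q ≡ not (Q p)

atLeastTwo? : ∀ {n} (X : VSubset n) → Dec (AtLeastTwo X)
atLeastTwo? X = any? λ x → any? λ y → ¬? (x ≟ y) ×-dec X x ≟ᵇ true ×-dec X y ≟ᵇ true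

atLeastTwo⇒ordered : ∀ {n} {X : VSubset n} → AtLeastTwo X →
  Σ (Fin n) λ x → Σ (Fin n) λ y → toℕ x < toℕ y × X x ≡ true × X y ≡ true
atLeastTwo⇒ordered (x , y , x≢y , x∈ , y∈) with <-cmp (toℕ x) (toℕ y)
... | tri< x<y _ _ = x , y , x<y , x∈ , y∈
... | tri≈ _ x≡y _ = ⊥-elim (x≢y (toℕ-injective x≡y))
... | tri> _ _ y<x = y , x , y<x , y∈ , x∈

next : ∀ {n} {x y : Fin n} → toℕ x < toℕ y → Fin n
next {y = y} x<y = fromℕ< (≤-<-trans x<y (toℕ<n y))

toℕ-next : ∀ {n} {x y : Fin n} (x<y : toℕ x < toℕ y) → toℕ (next x<y) ≡ suc (toℕ x)
toℕ-next x<y = toℕ-fromℕ< _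

adjacent-sameSide : ∀ {n} {p q y : Fin n} → toℕ q ≡ suc (toℕ p) → y ≢ p → y ≢ q →
  (toℕ y < toℕ p × toℕ y < toℕ q) ⊎ (toℕ p < toℕ y × toℕ q < toℕ y)
adjacent-sameSide {p = p} {q} {y} q≡1+p y≢p y≢q with <-cmp (toℕ y) (toℕ p)
... | tri< y<p _ _ = inj₁ (y<p , subst (toℕ y <_) (sym q≡1+p) (<-trans y<p ≤-refl))
... | tri≈ _ y≡p _ = ⊥-elim (y≢p (toℕ-injective y≡p))
... | tri> _ _ p<y = inj₂ (p<y , ≤∧≢⇒< (subst (_≤ toℕ y) (sym q≡1+p) p<y) (y≢q ∘ sym ∘ toℕ-injective))

pair : ∀ {n} → Fin n → Fin n → VSubset n
pair p q z = does (z ≟ p) ∨ does (z ≟ q)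

pair-member : ∀ {n} (p q z : Fin n) → pair p q z ≡ true → z ≡ p ⊎ z ≡ q
pair-member p q z z∈ with z ≟ p | z ≟ q
... | yes z≡p | _       = inj₁ z≡p
... | no _    | yes z≡q = inj₂ z≡q
pair-member p q z () | no _ | no _

pair-∋ˡ : ∀ {n} (p q : Fin n) → pair p q p ≡ true
pair-∋ˡ p q rewrite dec-true (p ≟ p) refl = refl

pair-∋ʳ : ∀ {n} (p q : Fin n) → pair p q q ≡ true
pair-∋ʳ p q rewrite dec-true (q ≟ q) refl with does (q ≟ p)
... | true  = refl
... | false = refl

pair-atLeastTwo : ∀ {n} {p q : Fin n} → p ≢ q → AtLeastTwo (pair p q)
pair-atLeastTwo {p = p} {q} p≢q = p , q , p≢q , pair-∋ˡ p q , pair-∋ʳ p q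

pair-acyclic : ∀ {n} {T : Digraph n} {p q : Fin n} → (∀ x → T x x ≡ false) → AcyclicOn T (pair p q)
pair-acyclic {p = p} {q} irreflexive (a , b , c , a∈ , b∈ , c∈ , ab , bc , ca)
  with pair-member p q a a∈ | pair-member p q b b∈ | pair-member p q c c∈
... | inj₁ refl | inj₁ refl | _         = true≢false (trans (sym ab) (irreflexive a))
... | inj₂ refl | inj₂ refl | _         = true≢false (trans (sym ab) (irreflexive a))
... | _         | inj₁ refl | inj₁ refl = true≢false (trans (sym bc) (irreflexive b))
... | _         | inj₂ refl | inj₂ refl = true≢false (trans (sym bc) (irreflexive b))
... | inj₁ refl | _         | inj₁ refl = true≢false (trans (sym ca) (irreflexive c))
... | inj₂ refl | _         | inj₂ refl = true≢false (trans (sym ca) (irreflexive c))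

pair-interval : ∀ {n} {T : Digraph n} {p q : Fin n} →
  (∀ y → pair p q y ≡ false → (T p y ≡ T q y) × (T y p ≡ T y q)) → IsInterval T (pair p q)
pair-interval {p = p} {q} same y x x′ y∉ x∈ x′∈ with pair-member p q x x∈ | pair-member p q x′ x′∈
... | inj₁ refl | inj₁ refl = refl , refl
... | inj₂ refl | inj₂ refl = refl , refl
... | inj₁ refl | inj₂ refl = same y y∉
... | inj₂ refl | inj₁ refl = let (e₁ , e₂) = same y y∉ in sym e₁ , sym e₂

invChain-adjacentPair-interval : ∀ {n} {Q : VSubset n} {p q : Fin n} → toℕ q ≡ suc (toℕ p) →
  Q p ≡ Q q → IsInterval (invChain Q) (pair p q)
invChain-adjacentPair-interval {p = p} {q} q≡1+p Qp≡Qq = pair-interval λ y y∉ →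
  invArc-sameSide Qp≡Qq (adjacent-sameSide q≡1+p
    (∈∉⇒≢ (pair-∋ˡ p q) y∉ ∘ sym) (∈∉⇒≢ (pair-∋ʳ p q) y∉ ∘ sym))

indecomposable⇒alternating : ∀ {n} {Q : VSubset n} → AcyclicallyIndecomposable (invChain Q) → Alternating Q
indecomposable⇒alternating {Q = Q} ind p q q≡1+p = ¬-not λ Qq≡Qp →
  ind (pair p q) (invChain-adjacentPair-interval {Q = Q} q≡1+p (sym Qq≡Qp)) (pair-atLeastTwo p≢q)
      (pair-acyclic {T = invChain Q} (invChain-irrefl Q))
  where
  p≢q : p ≢ q
  p≢q refl = 1+n≢n (sym q≡1+p)

indecomposable⇒atLeastTwo : ∀ {n} {Q : VSubset n} → 2 ≤ n → AcyclicallyIndecomposable (invChain Q) →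
  AtLeastTwo Q
indecomposable⇒atLeastTwo {suc zero} (s≤s ())
indecomposable⇒atLeastTwo {suc (suc n)} {Q} _ ind with atLeastTwo? Q
... | yes two = two
... | no ¬two =
  ⊥-elim (ind (λ _ → true) (λ _ _ _ ()) (zero , suc zero , (λ ()) , refl , refl)
              (forward⇒acyclic forward))
  where
  forward : ∀ x y → invChain Q x y ≡ true → toℕ x < toℕ y
  forward x y xy with invArc-true {Q x} {Q y} xy
  ... | inj₁ x<y = x<y
  ... | inj₂ (y<x , both) = ⊥-elim (¬two (x , y , x≢y , ∧-true both))
    where
    x≢y : x ≢ y
    x≢y refl = <-irrefl refl y<x

module AlternatingInterval {n} {Q : VSubset n} (alternating : Alternating Q)
                           {I : VSubset n} (interval : IsInterval (invChain Q) I) where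

  between : ∀ {a b c} → toℕ a < toℕ c → toℕ c < toℕ b → I a ≡ true → I b ≡ true → I c ≡ false →
    Q c ≡ true × Q b ≡ not (Q a)
  between {a} {b} {c} a<c c<b a∈ b∈ c∉ = boolean (Q a) (Q b) (Q c) (begin
    not (Q a ∧ Q c) ≡⟨ sym (invArc-< (Q a) (Q c) a<c) ⟩
    invChain Q a c  ≡⟨ proj₁ (interval c a b c∉ a∈ b∈) ⟩
    invChain Q b c  ≡⟨ invArc-> (Q b) (Q c) c<b ⟩
    Q b ∧ Q c       ∎)
    where
    open ≡-Reasoning
    boolean : ∀ x y z → not (x ∧ z) ≡ y ∧ z → z ≡ true × y ≡ not x
    boolean true  false true  _ = refl , refl
    boolean false true  true  _ = refl , refl
    boolean true  true  true  ()
    boolean false false true  ()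
    boolean true  true  false ()
    boolean true  false false ()
    boolean false true  false ()
    boolean false false false ()

  AdjacentMembers : Set
  AdjacentMembers = Σ (Fin n) λ p → Σ (Fin n) λ q → toℕ q ≡ suc (toℕ p) × I p ≡ true × I q ≡ true

  -- If the successor c of a lies outside I, then c ∈ Q and a ∉ Q; this forces the successor c′ of c into I,
  -- and the search continues from c′.
  adjacentMembers : ∀ {a b} → Acc _>_ a → toℕ a < toℕ b → I a ≡ true → I b ≡ true → AdjacentMembers
  adjacentMembers {a} {b} (acc further) a<b a∈ b∈ with I (next a<b) in c∈
  ... | true  = a , next a<b , toℕ-next a<b , a∈ , c∈
  ... | false = adjacentMembers (further {c′} a<c′) c′<b c′∈ b∈
    where
    c = next a<b
    a<c : toℕ a < toℕ c
    a<c = subst (toℕ a <_) (sym (toℕ-next a<b)) ≤-refl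
    c<b : toℕ c < toℕ b
    c<b = ≤∧≢⇒< (subst (_≤ toℕ b) (sym (toℕ-next a<b)) a<b) (∈∉⇒≢ {X = I} b∈ c∈ ∘ sym ∘ toℕ-injective)
    Qc : Q c ≡ true
    Qc = proj₁ (between a<c c<b a∈ b∈ c∈)
    Qb : Q b ≡ true
    Qb = trans (proj₂ (between a<c c<b a∈ b∈ c∈)) (trans (sym (alternating a c (toℕ-next a<b))) Qc)
    c′ = next c<b
    Qc′ : Q c′ ≡ false
    Qc′ = trans (alternating c c′ (toℕ-next c<b)) (cong not Qc)
    a<c′ : toℕ a < toℕ c′
    a<c′ = <-trans a<c (subst (toℕ c <_) (sym (toℕ-next c<b)) ≤-refl)
    c′<b : toℕ c′ < toℕ b
    c′<b = ≤∧≢⇒< (subst (_≤ toℕ b) (sym (toℕ-next c<b)) c<b) (∈∉⇒≢ {X = Q} Qb Qc′ ∘ sym ∘ toℕ-injective)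
    c′∈ : I c′ ≡ true
    c′∈ with I c′ in c′∉
    ... | true  = refl
    ... | false = ⊥-elim (true≢false (trans (sym (proj₁ (between a<c′ c′<b a∈ b∈ c′∉))) Qc′))

  members-inside : ∀ {p q} → toℕ q ≡ suc (toℕ p) → I p ≡ true → I q ≡ true → ∀ c → Q c ≡ true → I c ≡ true
  members-inside {p} {q} q≡1+p p∈ q∈ c Qc with I c in c∉
  ... | true  = refl
  ... | false = ⊥-elim (not-¬ (sym Qp≡Qq) (alternating p q q≡1+p))
    where
    seen : invArc true (Q p) (toℕ c) (toℕ p) ≡ invArc true (Q q) (toℕ c) (toℕ q)
    seen = subst (λ qc → invArc qc (Q p) (toℕ c) (toℕ p) ≡ invArc qc (Q q) (toℕ c) (toℕ q)) Qc
                 (proj₂ (interval c p q c∉ p∈ q∈))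
    Qp≡Qq : Q p ≡ Q q
    Qp≡Qq = invArc-separates
      (adjacent-sameSide q≡1+p (∈∉⇒≢ {X = I} p∈ c∉ ∘ sym) (∈∉⇒≢ {X = I} q∈ c∉ ∘ sym)) seen

  members⇒cycle : ∀ {u v} → toℕ u < toℕ v → Q u ≡ true → Q v ≡ true → I u ≡ true → I v ≡ true →
    HasCycle3In (invChain Q) I
  members⇒cycle {u} {v} u<v Qu Qv u∈ v∈ = u , c , v , u∈ , c∈ , v∈ , u→c , c→v , v→u
    where
    c = next u<v
    Qc : Q c ≡ false
    Qc = trans (alternating u c (toℕ-next u<v)) (cong not Qu)
    u<c : toℕ u < toℕ c
    u<c = subst (toℕ u <_) (sym (toℕ-next u<v)) ≤-refl
    c<v : toℕ c < toℕ v
    c<v = ≤∧≢⇒< (subst (_≤ toℕ v) (sym (toℕ-next u<v)) u<v) (∈∉⇒≢ {X = Q} Qv Qc ∘ sym ∘ toℕ-injective)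
    c∈ : I c ≡ true
    c∈ with I c in c∉
    ... | true  = refl
    ... | false = ⊥-elim (true≢false (trans (sym (proj₁ (between u<c c<v u∈ v∈ c∉))) Qc))
    u→c : invChain Q u c ≡ true
    u→c = proj₁ (invArc-forward {Q u} {Q c} (trans (cong (Q u ∧_) Qc) (∧-zeroʳ (Q u))) u<c)
    c→v : invChain Q c v ≡ true
    c→v = proj₁ (invArc-forward {Q c} {Q v} (cong (_∧ Q v) Qc) c<v)
    v→u : invChain Q v u ≡ true
    v→u = trans (invArc-> (Q v) (Q u) (<-trans u<c c<v)) (cong₂ _∧_ Qv Qu)

alternating⇒indecomposable : ∀ {n} {Q : VSubset n} → Alternating Q → AtLeastTwo Q →
  AcyclicallyIndecomposable (invChain Q)
alternating⇒indecomposable alternating twoQ I interval twoI acyclicI =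
  let (a , b , a<b , a∈ , b∈) = atLeastTwo⇒ordered twoI
      (p , q , q≡1+p , p∈ , q∈) = adjacentMembers (>-wellFounded a) a<b a∈ b∈
      (u , v , u<v , Qu , Qv) = atLeastTwo⇒ordered twoQ
      inside = members-inside q≡1+p p∈ q∈
  in acyclicI (members⇒cycle u<v Qu Qv (inside u Qu) (inside v Qv))
  where open AlternatingInterval alternating interval

alternate : Bool → ℕ → Bool
alternate true  k = isEven k
alternate false k = not (isEven k)

alternate-zero : ∀ b → alternate b 0 ≡ b
alternate-zero true  = refl
alternate-zero false = refl

alternate-suc : ∀ b k → alternate b (suc k) ≡ not (alternate b k)
alternate-suc true  k = refl
alternate-suc false k = refl

alternate-alternating : ∀ {n} b → Alternating (alternate b ∘ toℕ {n})
alternate-alternating b p q q≡1+p = trans (cong (alternate b) q≡1+p) (alternate-suc b (toℕ p))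

alternating⇒alternate : ∀ {n} {Q : VSubset (suc n)} → Alternating Q → ∀ x → Q x ≡ alternate (Q zero) (toℕ x)
alternating⇒alternate {Q = Q} alternating =
  <-weakInduction (λ x → Q x ≡ alternate b (toℕ x)) (sym (alternate-zero b)) λ i Qi → begin
    Q (suc i)                        ≡⟨ alternating (inject₁ i) (suc i) (cong suc (sym (toℕ-inject₁ i))) ⟩
    not (Q (inject₁ i))              ≡⟨ cong not Qi ⟩
    not (alternate b (toℕ (inject₁ i))) ≡⟨ cong (not ∘ alternate b) (toℕ-inject₁ i) ⟩
    not (alternate b (toℕ i))        ≡⟨ sym (alternate-suc b (toℕ i)) ⟩
    alternate b (suc (toℕ i))        ∎
  where
  b = Q zero
  open ≡-Reasoning

alternate-gap : ∀ b {i j} → alternate b i ≡ true → alternate b j ≡ true → i < j → suc i < j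
alternate-gap b {i} bi bj i<j = ≤∧≢⇒< i<j λ where
  refl → true≢false (trans (sym bj) (trans (alternate-suc b i) (cong not bi)))

-- The least n for which alternate b has two members among the positions below n.
minSize : Bool → ℕ
minSize true  = 3
minSize false = 4

alternate-minSize : ∀ b {i j} → alternate b i ≡ true → alternate b j ≡ true → i < j → minSize b ≤ suc j
alternate-minSize true bi bj i<j = s≤s (≤-trans (s≤s (s≤s z≤n)) (alternate-gap true bi bj i<j))
alternate-minSize false {suc i} bi bj i<j =
  s≤s (≤-trans (s≤s (s≤s (s≤s z≤n))) (alternate-gap false bi bj i<j))

atLeastTwo⇒minSize : ∀ {n} {Q : VSubset n} b → (∀ x → Q x ≡ alternate b (toℕ x)) → AtLeastTwo Q →
  minSize b ≤ n
atLeastTwo⇒minSize b Q≡ two =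
  let (x , y , x<y , Qx , Qy) = atLeastTwo⇒ordered two
  in ≤-trans (alternate-minSize b (trans (sym (Q≡ x)) Qx) (trans (sym (Q≡ y)) Qy) x<y) (toℕ<n y)

atLeastTwo-at : ∀ {n} (P : ℕ → Bool) {i j} → i < j → j < n → P i ≡ true → P j ≡ true →
  AtLeastTwo (P ∘ toℕ {n})
atLeastTwo-at P {i} {j} i<j j<n Pi Pj =
  fromℕ< i<n , fromℕ< j<n , distinct ,
  trans (cong P (toℕ-fromℕ< i<n)) Pi , trans (cong P (toℕ-fromℕ< j<n)) Pj
  where
  i<n = <-trans i<j j<n
  distinct : fromℕ< i<n ≢ fromℕ< j<n
  distinct e = <-irrefl (trans (sym (toℕ-fromℕ< i<n)) (trans (cong toℕ e) (toℕ-fromℕ< j<n))) i<j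

minSize⇒atLeastTwo : ∀ b {n} → minSize b ≤ n → AtLeastTwo (alternate b ∘ toℕ {n})
minSize⇒atLeastTwo true  3≤n = atLeastTwo-at (alternate true) {0} {2} (s≤s z≤n) 3≤n refl refl
minSize⇒atLeastTwo false 4≤n = atLeastTwo-at (alternate false) {1} {3} (s≤s (s≤s z≤n)) 4≤n refl refl

lex2-blocks : ∀ {a b} {S₀ : Digraph a} {S₁ : Digraph b} (R : Digraph (a + b)) →
  (∀ i j → R (i ↑ˡ b) (j ↑ˡ b) ≡ S₀ i j) → (∀ i j → R (a ↑ʳ i) (a ↑ʳ j) ≡ S₁ i j) →
  (∀ i j → R (i ↑ˡ b) (a ↑ʳ j) ≡ true) → (∀ i j → R (a ↑ʳ j) (i ↑ˡ b) ≡ false) →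
  ∀ x y → lex2 S₀ S₁ x y ≡ R x y
lex2-blocks {a} R left right across back x y with splitAt a x in ex | splitAt a y in ey
... | inj₁ i | inj₁ j = trans (sym (left i j)) (cong₂ R (splitAt⁻¹-↑ˡ ex) (splitAt⁻¹-↑ˡ ey))
... | inj₂ i | inj₂ j = trans (sym (right i j)) (cong₂ R (splitAt⁻¹-↑ʳ ex) (splitAt⁻¹-↑ʳ ey))
... | inj₁ i | inj₂ j = trans (sym (across i j)) (cong₂ R (splitAt⁻¹-↑ˡ ex) (splitAt⁻¹-↑ʳ ey))
... | inj₂ i | inj₁ j = trans (sym (back j i)) (cong₂ R (splitAt⁻¹-↑ʳ ex) (splitAt⁻¹-↑ˡ ey))

lex2-one-invChain : ∀ {n} (P : ℕ → Bool) (S : Digraph n) → P 0 ≡ false →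
  (∀ x y → S x y ≡ invChain (P ∘ suc ∘ toℕ) x y) → ∀ x y → lex2 one S x y ≡ invChain (P ∘ toℕ) x y
lex2-one-invChain P S P0 S≡ zero zero = sym (invArc-irrefl (P 0) (P 0) 0)
lex2-one-invChain P S P0 S≡ zero (suc j) =
  sym (proj₁ (invArc-forward {P 0} {P (suc (toℕ j))} {0} {suc (toℕ j)}
                             (cong (_∧ P (suc (toℕ j))) P0) (s≤s z≤n)))
lex2-one-invChain P S P0 S≡ (suc i) zero =
  sym (proj₂ (invArc-forward {P 0} {P (suc (toℕ i))} {0} {suc (toℕ i)}
                             (cong (_∧ P (suc (toℕ i))) P0) (s≤s z≤n)))
lex2-one-invChain P S P0 S≡ (suc i) (suc j) = S≡ i j

lex2-invChain-one : ∀ {n} (P : ℕ → Bool) (S : Digraph n) → P n ≡ false →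
  (∀ x y → S x y ≡ invChain (P ∘ toℕ) x y) → ∀ x y → lex2 S one x y ≡ invChain (P ∘ toℕ) x y
lex2-invChain-one {n} P S Pn S≡ = lex2-blocks (invChain (P ∘ toℕ)) left right across back
  where
  arcAt : ℕ → ℕ → Bool
  arcAt i j = invArc (P i) (P j) i j
  toℕ-last : toℕ (n ↑ʳ zero {0}) ≡ n
  toℕ-last = trans (toℕ-↑ʳ n zero) (+-identityʳ n)
  forward : ∀ i → toℕ i < n → arcAt (toℕ i) n ≡ true × arcAt n (toℕ i) ≡ false
  forward i = invArc-forward {P (toℕ i)} {P n} (trans (cong (P (toℕ i) ∧_) Pn) (∧-zeroʳ (P (toℕ i))))
  left : ∀ i j → invChain (P ∘ toℕ) (i ↑ˡ 1) (j ↑ˡ 1) ≡ S i j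
  left i j = trans (cong₂ arcAt (toℕ-↑ˡ i 1) (toℕ-↑ˡ j 1)) (sym (S≡ i j))
  right : ∀ i j → invChain (P ∘ toℕ) (n ↑ʳ i) (n ↑ʳ j) ≡ one i j
  right zero zero = invChain-irrefl (P ∘ toℕ) (n ↑ʳ zero)
  across : ∀ i j → invChain (P ∘ toℕ) (i ↑ˡ 1) (n ↑ʳ j) ≡ true
  across i zero = trans (cong₂ arcAt (toℕ-↑ˡ i 1) toℕ-last) (proj₁ (forward i (toℕ<n i)))
  back : ∀ i j → invChain (P ∘ toℕ) (n ↑ʳ j) (i ↑ˡ 1) ≡ false
  back i zero = trans (cong₂ arcAt toℕ-last (toℕ-↑ˡ i 1)) (proj₂ (forward i (toℕ<n i)))

isEven-double : ∀ m → isEven (2 * m) ≡ true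
isEven-double zero    = refl
isEven-double (suc m) =
  trans (cong isEven (*-suc 2 m)) (trans (not-involutive (isEven (2 * m))) (isEven-double m))

lex2-one-U : ∀ m x y → lex2 one (U m) x y ≡ invChain (alternate false ∘ toℕ) x y
lex2-one-U m = lex2-one-invChain (alternate false) (U m) refl λ x y →
  sym (invChain-cong {Q = alternate false ∘ suc ∘ toℕ} (λ z → not-involutive (isEven (toℕ z))) x y)

lex2-U-one : ∀ m x y → lex2 (U m) one x y ≡ invChain (alternate true ∘ toℕ) x y
lex2-U-one m = lex2-invChain-one (alternate true) (U m) (cong not (isEven-double m)) λ _ _ → refl

lex3-one-U-one : ∀ m x y → lex3 one (U m) one x y ≡ invChain (alternate false ∘ toℕ) x y
lex3-one-U-one m =
  lex2-invChain-one (alternate false) (lex2 one (U m)) (cong (not ∘ not ∘ not) (isEven-double m))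
                    (lex2-one-U m)

Shape : ∀ {N} → Digraph N → ℕ → Set
Shape T n = (T ≅ U n) ⊎ (T ≅ lex2 one (U n)) ⊎ (T ≅ lex2 (U n) one) ⊎ (T ≅ lex3 one (U n) one)

shape-≅ : ∀ {N M n} {T : Digraph N} {S : Digraph M} → T ≅ S → Shape S n → Shape T n
shape-≅ {n = n} {S = S} T≅S (inj₁ S≅) = inj₁ (≅-trans {S = S} {U n} T≅S S≅)
shape-≅ {n = n} {S = S} T≅S (inj₂ (inj₁ S≅)) = inj₂ (inj₁ (≅-trans {S = S} {lex2 one (U n)} T≅S S≅))
shape-≅ {n = n} {S = S} T≅S (inj₂ (inj₂ (inj₁ S≅))) =
  inj₂ (inj₂ (inj₁ (≅-trans {S = S} {lex2 (U n) one} T≅S S≅)))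
shape-≅ {n = n} {S = S} T≅S (inj₂ (inj₂ (inj₂ S≅))) =
  inj₂ (inj₂ (inj₂ (≅-trans {S = S} {lex3 one (U n) one} T≅S S≅)))

≥3⇒1+2n⊎2+2n : ∀ {N} → 3 ≤ N → Σ ℕ λ n → 1 ≤ n × (N ≡ suc (2 * n) ⊎ N ≡ suc (2 * n) + 1)
≥3⇒1+2n⊎2+2n 3≤N =
  let (k , 3+k≡N) = m≤n⇒∃[o]m+o≡n 3≤N
  in subst (λ N → Σ ℕ λ n → 1 ≤ n × (N ≡ suc (2 * n) ⊎ N ≡ suc (2 * n) + 1)) 3+k≡N (offset k)
  where
  offset : ∀ k → Σ ℕ λ n → 1 ≤ n × (3 + k ≡ suc (2 * n) ⊎ 3 + k ≡ suc (2 * n) + 1)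
  offset zero          = 1 , ≤-refl , inj₁ refl
  offset (suc zero)    = 1 , ≤-refl , inj₂ refl
  offset (suc (suc k)) with offset k
  ... | n , _ , inj₁ e =
    suc n , s≤s z≤n , inj₁ (trans (cong (2 +_) e) (cong suc (sym (*-suc 2 n))))
  ... | n , _ , inj₂ e =
    suc n , s≤s z≤n , inj₂ (trans (cong (2 +_) e) (cong (λ m → suc m + 1) (sym (*-suc 2 n))))

alternate-shape : ∀ b {N} → minSize b ≤ N → Σ ℕ λ n → 1 ≤ n × Shape (invChain {N} (alternate b ∘ toℕ)) n
alternate-shape true 3≤N with ≥3⇒1+2n⊎2+2n 3≤N
... | n , 1≤n , inj₁ refl = n , 1≤n , inj₁ (≗⇒≅ λ _ _ → refl)
... | n , 1≤n , inj₂ refl = n , 1≤n , inj₂ (inj₂ (inj₁ (≗⇒≅ λ x y → sym (lex2-U-one n x y))))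
alternate-shape false (s≤s 3≤N) with ≥3⇒1+2n⊎2+2n 3≤N
... | n , 1≤n , inj₁ refl = n , 1≤n , inj₂ (inj₁ (≗⇒≅ λ x y → sym (lex2-one-U n x y)))
... | n , 1≤n , inj₂ refl = n , 1≤n , inj₂ (inj₂ (inj₂ (≗⇒≅ λ x y → sym (lex3-one-U-one n x y))))

alternating-shape : ∀ {N} {Q : VSubset N} → Alternating Q → AtLeastTwo Q →
  Σ ℕ λ n → 1 ≤ n × Shape (invChain Q) n
alternating-shape {suc N} {Q} alternating two =
  let (n , 1≤n , shape) = alternate-shape (Q zero) (atLeastTwo⇒minSize (Q zero) Q≡ two)
  in n , 1≤n ,
     shape-≅ {n = n} {S = invChain (alternate (Q zero) ∘ toℕ)} (≗⇒≅ (invChain-cong Q≡)) shape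
  where
  Q≡ = alternating⇒alternate alternating

3≤1+2n : ∀ {n} → 1 ≤ n → 3 ≤ suc (2 * n)
3≤1+2n 1≤n = s≤s (*-monoʳ-≤ 2 1≤n)

shape⇒alternate : ∀ {N n} {T : Digraph N} → 1 ≤ n → Shape T n →
  Σ ℕ λ M → Σ Bool λ b → minSize b ≤ M × T ≅ invChain {M} (alternate b ∘ toℕ)
shape⇒alternate 1≤n (inj₁ T≅) = _ , true , 3≤1+2n 1≤n , T≅
shape⇒alternate {n = n} 1≤n (inj₂ (inj₁ T≅)) = _ , false , s≤s (3≤1+2n 1≤n) ,
  ≅-trans {S = lex2 one (U n)} {invChain (alternate false ∘ toℕ)} T≅ (≗⇒≅ (lex2-one-U n))
shape⇒alternate {n = n} 1≤n (inj₂ (inj₂ (inj₁ T≅))) = _ , true , ≤-trans (3≤1+2n 1≤n) (m≤m+n _ 1) ,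
  ≅-trans {S = lex2 (U n) one} {invChain (alternate true ∘ toℕ)} T≅ (≗⇒≅ (lex2-U-one n))
shape⇒alternate {n = n} 1≤n (inj₂ (inj₂ (inj₂ T≅))) =
  _ , false , ≤-trans (s≤s (3≤1+2n 1≤n)) (m≤m+n _ 1) ,
  ≅-trans {S = lex3 one (U n) one} {invChain (alternate false ∘ toℕ)} T≅ (≗⇒≅ (lex3-one-U-one n))

alternate-indecomposable-index≤1 : ∀ {N M} {T : Digraph N} b → minSize b ≤ M →
  T ≅ invChain {M} (alternate b ∘ toℕ) → AcyclicallyIndecomposable T × InvIndexAtMost 1 T
alternate-indecomposable-index≤1 {T = T} b bound T≅ =
  indecomposable-≅ {S = T} (≅-sym {S = invChain (alternate b ∘ toℕ)} T≅)
    (alternating⇒indecomposable (alternate-alternating b) (minSize⇒atLeastTwo b bound)) ,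
  index≤1-≅ {S = invChain (alternate b ∘ toℕ)} T≅ (invChain-index≤1 (alternate b ∘ toℕ))

mainTheorem7 : ∀ (N : ℕ) (T : Digraph N) → IsTournament T → 2 ≤ N →
    ((AcyclicallyIndecomposable T × InvIndexAtMost 1 T) ⇔
     Σ ℕ (λ n → (1 ≤ n) ×
       ((T ≅ U n) ⊎ (T ≅ lex2 one (U n)) ⊎ (T ≅ lex2 (U n) one) ⊎ (T ≅ lex3 one (U n) one))))
mainTheorem7 N T tournament 2≤N = mk⇔ classify standard
  where
  classify : AcyclicallyIndecomposable T × InvIndexAtMost 1 T → Σ ℕ λ n → 1 ≤ n × Shape T n
  classify (ind , idx) =
    let (Q , T≅Q) = index≤1⇒≅invChain tournament idx
        indQ = indecomposable-≅ {S = invChain Q} T≅Q ind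
        (n , 1≤n , shape) =
          alternating-shape (indecomposable⇒alternating {Q = Q} indQ) (indecomposable⇒atLeastTwo 2≤N indQ)
    in n , 1≤n , shape-≅ {n = n} {S = invChain Q} T≅Q shape
  standard : (Σ ℕ λ n → 1 ≤ n × Shape T n) → AcyclicallyIndecomposable T × InvIndexAtMost 1 T
  standard (n , 1≤n , shape) =
    let (_ , b , bound , T≅) = shape⇒alternate 1≤n shape
    in alternate-indecomposable-index≤1 b bound T≅
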